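{- Let $V$ be a set of propositional variables, let $2^V$ be the set of all valuations $v:V\to\{0,1\}$, and let $\mathbb{A}$ be the set of all downward closed collections of subsets of $2^V$ (i.e. sets $\mathcal{X}\subseteq\mathcal{P}(2^V)$ such that $S'\subseteq S\in\mathcal{X}$ implies $S'\in\mathcal{X}$), with the operation $$\mathcal{Y}\Rightarrow\mathcal{Z}:=\{S\subseteq 2^V\mid \text{for all } S'\subseteq S,\ \text{if } S'\in\mathcal{Y} \text{ then } S'\in\mathcal{Z}\}.$$ For $X\subseteq 2^V$ put ${\downarrow}X:=\{S\mid S\subseteq X\}\in\mathbb{A}$. Then for every $X\subseteq 2^V$ and all $\mathcal{Y},\mathcal{Z}\in\mathbb{A}$, $$({\downarrow}X)\Rightarrow(\mathcal{Y}\cup\mathcal{Z})\ \subseteq\ \big(({\downarrow}X)\Rightarrow\mathcal{Y}\big)\cup\big(({\downarrow}X)\Rightarrow\mathcal{Z}\big).$$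
   Context: Elements of $2^V$ are called possible worlds, subsets of $2^V$ are called teams (information states). $\mathbb{A}$ is ordered by inclusion. -}

module Defs where

open import Level using (0ℓ; suc; Lift)
open import Data.Bool using (Bool)
open import Relation.Unary using (Pred; _⊆_)

World : Set → Set
World V = V → Bool

Team : Set → Set₁
Team V = Pred (World V) 0ℓ

Coll : Set → Set₂
Coll V = Pred (Team V) (suc 0ℓ)

DownClosed : {V : Set} → Coll V → Set₁
DownClosed {V} 𝒳 = ∀ {S S' : Team V} → S' ⊆ S → 𝒳 S → 𝒳 S'

_⇒_ : {V : Set} → Coll V → Coll V → Coll V
_⇒_ {V} 𝒴 𝒵 S = ∀ (S' : Team V) → S' ⊆ S → 𝒴 S' → 𝒵 S'

↓ : {V : Set} → Team V → Coll V
↓ X S = Lift (suc 0ℓ) (S ⊆ X)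

-- Below S, the teams in ↓X have a greatest element, S ∩ X. So membership of S in
-- ↓X ⇒ 𝒴 reduces, for down-closed 𝒴, to the single test 𝒴 (S ∩ X), and a
-- single test of 𝒴 ∪ 𝒵 is decided by one of its two disjuncts.
module Submission where

open import Defs
open import Relation.Unary using (_⊆_; _∪_; _∩_)
open import Data.Sum using (inj₁; inj₂; [_,_])
open import Data.Product using (_,_; proj₁; proj₂)
open import Level using (lift)
open import Function using (_∘_)

module _ {V : Set} (X : Team V) where

  ∩-greatest-in-↓ : ∀ {S S' : Team V} → S' ⊆ S → ↓ X S' → S' ⊆ S ∩ X
  ∩-greatest-in-↓ S'⊆S (lift S'⊆X) p = S'⊆S p , S'⊆X p

  ⇒-at-∩ : ∀ {𝒴 : Coll V} {S : Team V} → (↓ X ⇒ 𝒴) S → 𝒴 (S ∩ X)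
  ⇒-at-∩ {S = S} h = h (S ∩ X) proj₁ (lift proj₂)

  ∩-⇒ : ∀ {𝒴 : Coll V} {S : Team V} → DownClosed 𝒴 → 𝒴 (S ∩ X) → (↓ X ⇒ 𝒴) S
  ∩-⇒ down-𝒴 y S' S'⊆S S'∈↓X = down-𝒴 (∩-greatest-in-↓ S'⊆S S'∈↓X) y

mainTheorem1 : (V : Set) (X : Team V) (𝒴 𝒵 : Coll V) →
    DownClosed 𝒴 → DownClosed 𝒵 →
    (↓ X ⇒ (𝒴 ∪ 𝒵)) ⊆ ((↓ X ⇒ 𝒴) ∪ (↓ X ⇒ 𝒵))
mainTheorem1 V X 𝒴 𝒵 down-𝒴 down-𝒵 h =
  [ inj₁ ∘ ∩-⇒ X down-𝒴 , inj₂ ∘ ∩-⇒ X down-𝒵 ] (⇒-at-∩ X h)
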